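{- Let $\sigma^1, \ldots, \sigma^K$ be permutations and, for each $q \in [1..K]$, let $i_q < h_q \le j_q$ and $a_q < c_q \le b_q$ be integers. Let $\pi_1$ be a separable permutation which, for every $q$, has an occurrence in $\sigma^q$ using the interval $[i_q..h_q-1]$ of indices and $[a_q..c_q-1]$ (resp. $[c_q..b_q]$) of values, and let $\pi_2$ be a separable permutation which, for every $q$, has an occurrence in $\sigma^q$ using the interval $[h_q..j_q]$ of indices and $[c_q..b_q]$ (resp. $[a_q..c_q-1]$) of values. Then $\pi = \pi_1 \oplus \pi_2$ (resp. $\pi = \pi_1 \ominus \pi_2$) is a separable permutation which, for every $q \in [1..K]$, has an occurrence in $\sigma^q$ using the interval $[i_q..j_q]$ of indices and $[a_q..b_q]$ of values.
   Context: A permutation of length $n$ is a bijection of $[1..n]$, written $\sigma_1\cdots\sigma_n$; $\sigma_i$ is the value at index $i$. A permutation $\pi$ of length $k$ has an occurrence $\sigma_{i_1}\cdots\sigma_{i_k}$ ($i_1<\cdots<i_k$) in $\sigma$ if $\sigma_{i_\ell} < \sigma_{i_m}$ whenever $\pi_\ell < \pi_m$; the occurrence uses the interval $I$ of indices and $V$ of values if $\{i_1,\ldots,i_k\} \subseteq I$ and $\{\sigma_{i_1},\ldots,\sigma_{i_k}\} \subseteq V$. A permutation is separable if it involves neither $2413$ nor $3142$ as a pattern. For $\pi$ of length $k$ and $\pi'$ of length $k'$: $\pi \oplus \pi' = \pi_1\cdots\pi_k(\pi'_1+k)\cdots(\pi'_{k'}+k)$ and $\pi \ominus \pi' = (\pi_1+k')\cdots(\pi_k+k')\pi'_1\cdots\pi'_{k'}$.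 -}

module Defs where

open import Data.Nat as ℕ using (ℕ; zero; suc)
open import Data.Nat.Properties using (+-comm)
open import Data.Fin as Fin using (Fin; toℕ; splitAt; _↑ˡ_; _↑ʳ_; cast)
open import Data.Integer as ℤ using (ℤ; +_)
open import Data.Sum using (inj₁; inj₂)
open import Data.Product using (Σ; _×_)
open import Relation.Nullary using (¬_)
open import Function.Definitions using (Bijective)
open import Relation.Binary.PropositionalEquality using (_≡_)

-- A permutation of length n is a bijection Fin n → Fin n.
-- Index/value x : Fin n stands for the 1-based number toℕ x + 1.
IsPerm : ∀ {n} → (Fin n → Fin n) → Set
IsPerm f = Bijective _≡_ _≡_ f

pos : ∀ {n} → Fin n → ℤ
pos x = + (suc (toℕ x))

InInterval : ℤ → ℤ → ℤ → Set
InInterval lo hi z = lo ℤ.≤ z × z ℤ.≤ hi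

OccursIn : ∀ {k n} → (Fin k → Fin k) → (Fin n → Fin n) →
           ℤ → ℤ → ℤ → ℤ → Set
OccursIn {k} {n} π σ iLo iHi vLo vHi =
  Σ (Fin k → Fin n) λ e →
    (∀ l m → l Fin.< m → e l Fin.< e m) ×
    (∀ l m → π l Fin.< π m → σ (e l) Fin.< σ (e m)) ×
    (∀ l → InInterval iLo iHi (pos (e l))) ×
    (∀ l → InInterval vLo vHi (pos (σ (e l))))

Occurs : ∀ {k n} → (Fin k → Fin k) → (Fin n → Fin n) → Set
Occurs {k} {n} π σ =
  Σ (Fin k → Fin n) λ e →
    (∀ l m → l Fin.< m → e l Fin.< e m) ×
    (∀ l m → π l Fin.< π m → σ (e l) Fin.< σ (e m))

-- the patterns 2413 and 3142 (0-based values)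
p2413 : Fin 4 → Fin 4
p2413 Fin.zero = Fin.suc Fin.zero
p2413 (Fin.suc Fin.zero) = Fin.suc (Fin.suc (Fin.suc Fin.zero))
p2413 (Fin.suc (Fin.suc Fin.zero)) = Fin.zero
p2413 (Fin.suc (Fin.suc (Fin.suc Fin.zero))) = Fin.suc (Fin.suc Fin.zero)

p3142 : Fin 4 → Fin 4
p3142 Fin.zero = Fin.suc (Fin.suc Fin.zero)
p3142 (Fin.suc Fin.zero) = Fin.zero
p3142 (Fin.suc (Fin.suc Fin.zero)) = Fin.suc (Fin.suc (Fin.suc Fin.zero))
p3142 (Fin.suc (Fin.suc (Fin.suc Fin.zero))) = Fin.suc Fin.zero

Separable : ∀ {n} → (Fin n → Fin n) → Set
Separable σ = ¬ Occurs p2413 σ × ¬ Occurs p3142 σ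

_⊕_ : ∀ {k k'} → (Fin k → Fin k) → (Fin k' → Fin k') → Fin (k ℕ.+ k') → Fin (k ℕ.+ k')
_⊕_ {k} {k'} π π' x with splitAt k x
... | inj₁ y = π y ↑ˡ k'
... | inj₂ y = k ↑ʳ π' y

_⊖_ : ∀ {k k'} → (Fin k → Fin k) → (Fin k' → Fin k') → Fin (k ℕ.+ k') → Fin (k ℕ.+ k')
_⊖_ {k} {k'} π π' x with splitAt k x
... | inj₁ y = cast (+-comm k' k) (k' ↑ʳ π y)
... | inj₂ y = cast (+-comm k' k) (π' y ↑ˡ k)

{-# OPTIONS --safe #-}

-- π₁ ⊕ π₂ acts on its first k₁ positions as π₁ and on the remaining ones as π₂ shifted up
-- by k₁ (for π₁ ⊖ π₂ the first block is shifted up by k₂ instead). Hence it is injective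
-- blockwise, and an injective endomap of Fin n is a bijection. The patterns 2413 and 3142
-- are neither direct nor skew sums, so every cut of them is crossed by an inversion and by a
-- non-inversion; an occurrence of either in π₁ ⊕ π₂ or π₁ ⊖ π₂ that straddled the two
-- blocks would thus contradict the fixed order between the blocks' values, so it lies in
-- π₁ or in π₂. Finally, concatenating the given occurrences of π₁ and π₂ in σ gives one of
-- the sum: their index intervals are consecutive and their value intervals are ordered
-- exactly as the values of the two blocks.

module Submission where

open import Defs
open import Data.Nat using (ℕ)
open import Data.Fin using (Fin)
open import Data.Integer using (ℤ; +_; _<_; _≤_; _-_)
open import Data.Product using (_×_)

import Data.Nat as ℕ
open import Data.Nat using (z≤n; z<s)
import Data.Nat.Properties as ℕₚ
import Data.Fin as Fin
open import Data.Fin using (toℕ; _↑ˡ_; _↑ʳ_; splitAt)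
open import Data.Fin.Patterns using (0F)
import Data.Fin.Properties as Finₚ
open import Data.Integer using (-1ℤ)
import Data.Integer.Properties as ℤₚ
open import Data.Vec.Functional using (_++_)
open import Data.Vec.Functional.Properties using (lookup-++ˡ; lookup-++ʳ)
open import Data.Vec.Functional.Relation.Unary.All using (All)
open import Data.Vec.Functional.Relation.Unary.All.Properties using (++⁺)
open import Data.Product using (∃₂; _,_)
open import Data.Sum using (_⊎_; inj₁; inj₂; [_,_]′)
open import Function using (_∘_)
open import Function.Definitions using (Injective; Surjective)
open import Relation.Nullary using (¬_; Dec; yes; no; contradiction)
open import Relation.Nullary.Decidable using (from-yes; _×-dec_; _→-dec_)
open import Relation.Binary.Definitions using (Decidable)
open import Relation.Binary.PropositionalEquality
  using (_≡_; _≢_; refl; sym; trans; cong; subst; subst₂)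

injective⇒surjective : ∀ {n} {f : Fin n → Fin n} →
                       Injective _≡_ _≡_ f → Surjective _≡_ _≡_ f
injective⇒surjective {ℕ.suc n} {f} f-injective y
  with Finₚ.any? (λ x → f x Finₚ.≟ y)
... | yes (x , fx≡y) = x , λ { refl → fx≡y }
... | no y∉image = contradiction (Finₚ.injective⇒≤ g-injective) ℕₚ.1+n≰n
  where
    y≢f : ∀ x → y ≢ f x
    y≢f x y≡fx = y∉image (x , sym y≡fx)

    g : Fin (ℕ.suc n) → Fin n
    g x = Fin.punchOut (y≢f x)

    g-injective : Injective _≡_ _≡_ g
    g-injective {x} {x'} = f-injective ∘ Finₚ.punchOut-injective (y≢f x) (y≢f x')

injective⇒isPerm : ∀ {n} {f : Fin n → Fin n} → Injective _≡_ _≡_ f → IsPerm f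
injective⇒isPerm f-injective = f-injective , injective⇒surjective f-injective

data Block (k₁ k₂ : ℕ) : Fin (k₁ ℕ.+ k₂) → Set where
  left  : (y : Fin k₁) → Block k₁ k₂ (y ↑ˡ k₂)
  right : (y : Fin k₂) → Block k₁ k₂ (k₁ ↑ʳ y)

block : ∀ k₁ k₂ (x : Fin (k₁ ℕ.+ k₂)) → Block k₁ k₂ x
block k₁ k₂ x with splitAt k₁ x in eq
... | inj₁ y = subst (Block k₁ k₂) (Finₚ.splitAt⁻¹-↑ˡ eq) (left y)
... | inj₂ y = subst (Block k₁ k₂) (Finₚ.splitAt⁻¹-↑ʳ eq) (right y)

module _ {k₁ k₂ : ℕ} where

  ↑ˡ-cancel-< : ∀ {y y' : Fin k₁} → y ↑ˡ k₂ Fin.< y' ↑ˡ k₂ → y Fin.< y'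
  ↑ˡ-cancel-< {y} {y'} = subst₂ ℕ._<_ (Finₚ.toℕ-↑ˡ y k₂) (Finₚ.toℕ-↑ˡ y' k₂)

  ↑ʳ-cancel-< : ∀ {y y' : Fin k₂} → k₁ ↑ʳ y Fin.< k₁ ↑ʳ y' → y Fin.< y'
  ↑ʳ-cancel-< {y} {y'} =
    ℕₚ.+-cancelˡ-< k₁ _ _ ∘ subst₂ ℕ._<_ (Finₚ.toℕ-↑ʳ k₁ y) (Finₚ.toℕ-↑ʳ k₁ y')

  ↑ˡ<↑ʳ : ∀ (y : Fin k₁) (y' : Fin k₂) → y ↑ˡ k₂ Fin.< k₁ ↑ʳ y'
  ↑ˡ<↑ʳ y y' = subst₂ ℕ._<_ (sym (Finₚ.toℕ-↑ˡ y k₂)) (sym (Finₚ.toℕ-↑ʳ k₁ y'))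
                 (ℕₚ.<-≤-trans (Finₚ.toℕ<n y) (ℕₚ.m≤m+n k₁ (toℕ y')))

  fromℕ<-↑ˡ : ∀ {x : Fin (k₁ ℕ.+ k₂)} (x<k₁ : toℕ x ℕ.< k₁) → Fin.fromℕ< x<k₁ ↑ˡ k₂ ≡ x
  fromℕ<-↑ˡ {x} x<k₁ = Finₚ.splitAt⁻¹-↑ˡ (Finₚ.splitAt-< k₁ x x<k₁)

  ↑ʳ-reduce≥ : ∀ {x : Fin (k₁ ℕ.+ k₂)} (k₁≤x : k₁ ℕ.≤ toℕ x) → k₁ ↑ʳ Fin.reduce≥ x k₁≤x ≡ x
  ↑ʳ-reduce≥ {x} k₁≤x = Finₚ.splitAt⁻¹-↑ʳ (Finₚ.splitAt-≥ k₁ x k₁≤x)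

  across-blocks : ∀ (R : Fin (k₁ ℕ.+ k₂) → Fin (k₁ ℕ.+ k₂) → Set) →
                  (∀ y y' → R (y ↑ˡ k₂) (k₁ ↑ʳ y')) →
                  ∀ {x z} → toℕ x ℕ.< k₁ → k₁ ℕ.≤ toℕ z → R x z
  across-blocks R R-across x<k₁ k₁≤z =
    subst₂ R (fromℕ<-↑ˡ x<k₁) (↑ʳ-reduce≥ k₁≤z) (R-across _ _)

StrictlyIncreasing : ∀ {k n} → (Fin k → Fin n) → Set
StrictlyIncreasing e = ∀ l m → l Fin.< m → e l Fin.< e m

IsOccurrence : ∀ {k n} → (Fin k → Fin k) → (Fin n → Fin n) → (Fin k → Fin n) → Set
IsOccurrence τ σ e = StrictlyIncreasing e × (∀ l m → τ l Fin.< τ m → σ (e l) Fin.< σ (e m))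

IsOccurrence-pullback :
  ∀ {k m n} {τ : Fin k → Fin k} {π : Fin m → Fin m} {p : Fin n → Fin n}
  (ι : Fin m → Fin n) →
  (∀ {a b} → ι a Fin.< ι b → a Fin.< b) →
  (∀ {a b} → p (ι a) Fin.< p (ι b) → π a Fin.< π b) →
  ∀ {e e'} → (∀ l → ι (e' l) ≡ e l) → IsOccurrence τ p e → IsOccurrence τ π e'
IsOccurrence-pullback {n = n} {p = p} ι ι-reflects-< pι-reflects-< {e} {e'} ιe'≡e
                      (increasing , preserves) =
  (λ l m l<m → ι-reflects-< (pull (λ u v → u Fin.< v) l m (increasing l m l<m))) ,
  (λ l m τl<τm → pι-reflects-< (pull (λ u v → p u Fin.< p v) l m (preserves l m τl<τm)))
  where
    pull : ∀ (R : Fin n → Fin n → Set) l m → R (e l) (e m) → R (ι (e' l)) (ι (e' m))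
    pull R l m = subst₂ R (sym (ιe'≡e l)) (sym (ιe'≡e m))

data Placement {k n : ℕ} (c : ℕ) (e : Fin k → Fin n) : Set where
  below : All (λ x → toℕ x ℕ.< c) e → Placement c e
  above : All (λ x → c ℕ.≤ toℕ x) e → Placement c e
  split : (m : Fin k) → 0 ℕ.< toℕ m →
          (∀ l → l Fin.< m → toℕ (e l) ℕ.< c) → (∀ l → m Fin.≤ l → c ℕ.≤ toℕ (e l)) →
          Placement c e

inject-fromℕ< : ∀ {k} {l m : Fin k} (l<m : l Fin.< m) → Fin.inject (Fin.fromℕ< l<m) ≡ l
inject-fromℕ< {l = l} l<m =
  Finₚ.toℕ-injective (trans (Finₚ.toℕ-inject (Fin.fromℕ< l<m)) (Finₚ.toℕ-fromℕ< l<m))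

module _ {k n : ℕ} (c : ℕ) {e : Fin k → Fin n} (increasing : StrictlyIncreasing e) where

  above-upwards : ∀ {m l} → m Fin.≤ l → c ℕ.≤ toℕ (e m) → c ℕ.≤ toℕ (e l)
  above-upwards {m} {l} m≤l c≤eₘ with ℕₚ.m≤n⇒m<n∨m≡n m≤l
  ... | inj₁ m<l = ℕₚ.<⇒≤ (ℕₚ.≤-<-trans c≤eₘ (increasing m l m<l))
  ... | inj₂ m≡l = subst (λ x → c ℕ.≤ toℕ (e x)) (Finₚ.toℕ-injective m≡l) c≤eₘ

  placement-from-first-above :
    ∀ m → ¬ toℕ (e m) ℕ.< c → ((j : Fin.Fin′ m) → toℕ (e (Fin.inject j)) ℕ.< c) → Placement c e
  placement-from-first-above 0F e₀≮c _ = above λ l → above-upwards z≤n (ℕₚ.≮⇒≥ e₀≮c)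
  placement-from-first-above m@(Fin.suc _) eₘ≮c belowBefore-m =
    split m z<s (λ l l<m → subst (λ x → toℕ (e x) ℕ.< c) (inject-fromℕ< l<m)
                                 (belowBefore-m (Fin.fromℕ< l<m)))
                (λ l m≤l → above-upwards m≤l (ℕₚ.≮⇒≥ eₘ≮c))

  placement : Placement c e
  placement with Finₚ.all? (λ l → toℕ (e l) ℕ.<? c)
  ... | yes allBelow = below allBelow
  ... | no notAllBelow with Finₚ.¬∀⟶∃¬-smallest k _ (λ l → toℕ (e l) ℕ.<? c) notAllBelow
  ...   | m , eₘ≮c , belowBefore-m = placement-from-first-above m eₘ≮c belowBefore-m

-- For R = _>_ this says that τ is not τ₁ ⊕ τ₂ with τ₁, τ₂ nonempty; for R = _<_, not τ₁ ⊖ τ₂.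
CutsCrossedBy : ∀ {k} → (Fin k → Fin k → Set) → (Fin k → Fin k) → Set
CutsCrossedBy {k} _R_ τ =
  (m : Fin k) → 0 ℕ.< toℕ m → ∃₂ λ l l' → l Fin.< m × m Fin.≤ l' × τ l R τ l'

SumIndecomposable SkewIndecomposable : ∀ {k} → (Fin k → Fin k) → Set
SumIndecomposable = CutsCrossedBy Fin._>_
SkewIndecomposable = CutsCrossedBy Fin._<_

cutsCrossedBy? : ∀ {k} {_R_ : Fin k → Fin k → Set} → Decidable _R_ →
                 (τ : Fin k → Fin k) → Dec (CutsCrossedBy _R_ τ)
cutsCrossedBy? R? τ = Finₚ.all? λ m → (0 ℕ.<? toℕ m) →-dec
  Finₚ.any? λ l → Finₚ.any? λ l' → (l Finₚ.<? m) ×-dec (m Finₚ.≤? l') ×-dec R? (τ l) (τ l')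

_>?_ : ∀ {k} → Decidable (Fin._>_ {k} {k})
a >? b = b Finₚ.<? a

2413-sumIndecomposable : SumIndecomposable p2413
2413-sumIndecomposable = from-yes (cutsCrossedBy? _>?_ p2413)

3142-sumIndecomposable : SumIndecomposable p3142
3142-sumIndecomposable = from-yes (cutsCrossedBy? _>?_ p3142)

2413-skewIndecomposable : SkewIndecomposable p2413
2413-skewIndecomposable = from-yes (cutsCrossedBy? Finₚ._<?_ p2413)

3142-skewIndecomposable : SkewIndecomposable p3142
3142-skewIndecomposable = from-yes (cutsCrossedBy? Finₚ._<?_ p3142)

module BlockSum {k₁ k₂ : ℕ} (π₁ : Fin k₁ → Fin k₁) (π₂ : Fin k₂ → Fin k₂)
  (p : Fin (k₁ ℕ.+ k₂) → Fin (k₁ ℕ.+ k₂)) (offsetˡ offsetʳ : ℕ)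
  (toℕ-p-↑ˡ : ∀ y → toℕ (p (y ↑ˡ k₂)) ≡ offsetˡ ℕ.+ toℕ (π₁ y))
  (toℕ-p-↑ʳ : ∀ y → toℕ (p (k₁ ↑ʳ y)) ≡ offsetʳ ℕ.+ toℕ (π₂ y)) where

  p-↑ˡ-reflects-< : ∀ {y y'} → p (y ↑ˡ k₂) Fin.< p (y' ↑ˡ k₂) → π₁ y Fin.< π₁ y'
  p-↑ˡ-reflects-< {y} {y'} =
    ℕₚ.+-cancelˡ-< offsetˡ _ _ ∘ subst₂ ℕ._<_ (toℕ-p-↑ˡ y) (toℕ-p-↑ˡ y')

  p-↑ʳ-reflects-< : ∀ {y y'} → p (k₁ ↑ʳ y) Fin.< p (k₁ ↑ʳ y') → π₂ y Fin.< π₂ y'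
  p-↑ʳ-reflects-< {y} {y'} =
    ℕₚ.+-cancelˡ-< offsetʳ _ _ ∘ subst₂ ℕ._<_ (toℕ-p-↑ʳ y) (toℕ-p-↑ʳ y')

  p-↑ˡ-injective : Injective _≡_ _≡_ π₁ → ∀ {y y'} → p (y ↑ˡ k₂) ≡ p (y' ↑ˡ k₂) → y ≡ y'
  p-↑ˡ-injective π₁-injective {y} {y'} eq =
    π₁-injective (Finₚ.toℕ-injective (ℕₚ.+-cancelˡ-≡ offsetˡ _ _
      (trans (sym (toℕ-p-↑ˡ y)) (trans (cong toℕ eq) (toℕ-p-↑ˡ y')))))

  p-↑ʳ-injective : Injective _≡_ _≡_ π₂ → ∀ {y y'} → p (k₁ ↑ʳ y) ≡ p (k₁ ↑ʳ y') → y ≡ y'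
  p-↑ʳ-injective π₂-injective {y} {y'} eq =
    π₂-injective (Finₚ.toℕ-injective (ℕₚ.+-cancelˡ-≡ offsetʳ _ _
      (trans (sym (toℕ-p-↑ʳ y)) (trans (cong toℕ eq) (toℕ-p-↑ʳ y')))))

  injective : Injective _≡_ _≡_ π₁ → Injective _≡_ _≡_ π₂ →
              (∀ y y' → p (y ↑ˡ k₂) ≢ p (k₁ ↑ʳ y')) → Injective _≡_ _≡_ p
  injective π₁-injective π₂-injective blocks-apart {x} {z} eq
    with block k₁ k₂ x | block k₁ k₂ z
  ... | left y  | left y'  = cong (_↑ˡ k₂) (p-↑ˡ-injective π₁-injective eq)
  ... | right y | right y' = cong (k₁ ↑ʳ_) (p-↑ʳ-injective π₂-injective eq)
  ... | left y  | right y' = contradiction eq (blocks-apart y y')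
  ... | right y | left y'  = contradiction (sym eq) (blocks-apart y' y)

  restrictˡ : ∀ {k} {τ : Fin k → Fin k} {e} → IsOccurrence τ p e →
              All (λ x → toℕ x ℕ.< k₁) e → Occurs τ π₁
  restrictˡ occurrence inLeft =
    (λ l → Fin.fromℕ< (inLeft l)) ,
    IsOccurrence-pullback {p = p} (_↑ˡ k₂) ↑ˡ-cancel-< p-↑ˡ-reflects-<
                          (fromℕ<-↑ˡ ∘ inLeft) occurrence

  restrictʳ : ∀ {k} {τ : Fin k → Fin k} {e} → IsOccurrence τ p e →
              All (λ x → k₁ ℕ.≤ toℕ x) e → Occurs τ π₂
  restrictʳ occurrence inRight =
    (λ l → Fin.reduce≥ _ (inRight l)) ,
    IsOccurrence-pullback {p = p} (k₁ ↑ʳ_) ↑ʳ-cancel-< p-↑ʳ-reflects-<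
                          (↑ʳ-reduce≥ ∘ inRight) occurrence

  ++-isOccurrence :
    ∀ {n} {σ : Fin n → Fin n} {e₁ e₂} → IsOccurrence π₁ σ e₁ → IsOccurrence π₂ σ e₂ →
    (∀ y y' → e₁ y Fin.< e₂ y') →
    (∀ y y' → p (y ↑ˡ k₂) Fin.< p (k₁ ↑ʳ y') → σ (e₁ y) Fin.< σ (e₂ y')) →
    (∀ y y' → p (k₁ ↑ʳ y') Fin.< p (y ↑ˡ k₂) → σ (e₂ y') Fin.< σ (e₁ y)) →
    IsOccurrence p σ (e₁ ++ e₂)
  ++-isOccurrence {σ = σ} {e₁} {e₂} (increasing₁ , preserves₁) (increasing₂ , preserves₂)
                  e₁<e₂ σ-up σ-down = increasing , preserves
    where
      increasing : StrictlyIncreasing (e₁ ++ e₂)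
      increasing x z x<z with block k₁ k₂ x | block k₁ k₂ z
      ... | left y  | left y'  rewrite lookup-++ˡ e₁ e₂ y | lookup-++ˡ e₁ e₂ y' =
        increasing₁ y y' (↑ˡ-cancel-< x<z)
      ... | right y | right y' rewrite lookup-++ʳ e₁ e₂ y | lookup-++ʳ e₁ e₂ y' =
        increasing₂ y y' (↑ʳ-cancel-< x<z)
      ... | left y  | right y' rewrite lookup-++ˡ e₁ e₂ y | lookup-++ʳ e₁ e₂ y' = e₁<e₂ y y'
      ... | right y | left y'  = contradiction x<z (ℕₚ.<-asym (↑ˡ<↑ʳ y' y))

      preserves : ∀ x z → p x Fin.< p z → σ ((e₁ ++ e₂) x) Fin.< σ ((e₁ ++ e₂) z)
      preserves x z px<pz with block k₁ k₂ x | block k₁ k₂ z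
      ... | left y  | left y'  rewrite lookup-++ˡ e₁ e₂ y | lookup-++ˡ e₁ e₂ y' =
        preserves₁ y y' (p-↑ˡ-reflects-< px<pz)
      ... | right y | right y' rewrite lookup-++ʳ e₁ e₂ y | lookup-++ʳ e₁ e₂ y' =
        preserves₂ y y' (p-↑ʳ-reflects-< px<pz)
      ... | left y  | right y' rewrite lookup-++ˡ e₁ e₂ y | lookup-++ʳ e₁ e₂ y' =
        σ-up y y' px<pz
      ... | right y | left y'  rewrite lookup-++ʳ e₁ e₂ y | lookup-++ˡ e₁ e₂ y' =
        σ-down y' y px<pz

pos-cancel-< : ∀ {n} {x y : Fin n} → pos x < pos y → x Fin.< y
pos-cancel-< = ℕ.s<s⁻¹ ∘ ℤₚ.drop‿+<+

≤-pred⇒< : ∀ {x c : ℤ} → x ≤ c - + 1 → x < c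
≤-pred⇒< {x} {c} = ℤₚ.i≤pred[j]⇒i<j ∘ subst (x ≤_) (ℤₚ.+-comm c -1ℤ)

lower-part-<-upper-part : ∀ {n} {x y : Fin n} {lo c hi : ℤ} →
  InInterval lo (c - + 1) (pos x) → InInterval c hi (pos y) → x Fin.< y
lower-part-<-upper-part (_ , x≤c-1) (c≤y , _) =
  pos-cancel-< (ℤₚ.<-≤-trans (≤-pred⇒< x≤c-1) c≤y)

lower-part-⊆ : ∀ {lo c hi z : ℤ} → c ≤ hi → InInterval lo (c - + 1) z → InInterval lo hi z
lower-part-⊆ c≤hi (lo≤z , z≤c-1) = lo≤z , ℤₚ.≤-trans (ℤₚ.<⇒≤ (≤-pred⇒< z≤c-1)) c≤hi

upper-part-⊆ : ∀ {lo c hi z : ℤ} → lo < c → InInterval c hi z → InInterval lo hi z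
upper-part-⊆ lo<c (c≤z , z≤hi) = ℤₚ.≤-trans (ℤₚ.<⇒≤ lo<c) c≤z , z≤hi

module _ {k₁ k₂ : ℕ} (π₁ : Fin k₁ → Fin k₁) (π₂ : Fin k₂ → Fin k₂) where

  toℕ-⊕-↑ˡ : ∀ y → toℕ ((π₁ ⊕ π₂) (y ↑ˡ k₂)) ≡ toℕ (π₁ y)
  toℕ-⊕-↑ˡ y rewrite Finₚ.splitAt-↑ˡ k₁ y k₂ = Finₚ.toℕ-↑ˡ (π₁ y) k₂

  toℕ-⊕-↑ʳ : ∀ y → toℕ ((π₁ ⊕ π₂) (k₁ ↑ʳ y)) ≡ k₁ ℕ.+ toℕ (π₂ y)
  toℕ-⊕-↑ʳ y rewrite Finₚ.splitAt-↑ʳ k₁ k₂ y = Finₚ.toℕ-↑ʳ k₁ (π₂ y)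

  toℕ-⊖-↑ˡ : ∀ y → toℕ ((π₁ ⊖ π₂) (y ↑ˡ k₂)) ≡ k₂ ℕ.+ toℕ (π₁ y)
  toℕ-⊖-↑ˡ y rewrite Finₚ.splitAt-↑ˡ k₁ y k₂ =
    trans (Finₚ.toℕ-cast _ (k₂ ↑ʳ π₁ y)) (Finₚ.toℕ-↑ʳ k₂ (π₁ y))

  toℕ-⊖-↑ʳ : ∀ y → toℕ ((π₁ ⊖ π₂) (k₁ ↑ʳ y)) ≡ toℕ (π₂ y)
  toℕ-⊖-↑ʳ y rewrite Finₚ.splitAt-↑ʳ k₁ k₂ y =
    trans (Finₚ.toℕ-cast _ (π₂ y ↑ˡ k₁)) (Finₚ.toℕ-↑ˡ (π₂ y) k₁)

  ⊕-↑ˡ<↑ʳ : ∀ y y' → (π₁ ⊕ π₂) (y ↑ˡ k₂) Fin.< (π₁ ⊕ π₂) (k₁ ↑ʳ y')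
  ⊕-↑ˡ<↑ʳ y y' = subst₂ ℕ._<_ (sym (toℕ-⊕-↑ˡ y)) (sym (toℕ-⊕-↑ʳ y'))
                   (ℕₚ.<-≤-trans (Finₚ.toℕ<n (π₁ y)) (ℕₚ.m≤m+n k₁ (toℕ (π₂ y'))))

  ⊖-↑ʳ<↑ˡ : ∀ y y' → (π₁ ⊖ π₂) (k₁ ↑ʳ y') Fin.< (π₁ ⊖ π₂) (y ↑ˡ k₂)
  ⊖-↑ʳ<↑ˡ y y' = subst₂ ℕ._<_ (sym (toℕ-⊖-↑ʳ y')) (sym (toℕ-⊖-↑ˡ y))
                   (ℕₚ.<-≤-trans (Finₚ.toℕ<n (π₂ y')) (ℕₚ.m≤m+n k₂ (toℕ (π₁ y))))

  module ⊕-Blocks = BlockSum π₁ π₂ (π₁ ⊕ π₂) 0 k₁ toℕ-⊕-↑ˡ toℕ-⊕-↑ʳ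
  module ⊖-Blocks = BlockSum π₁ π₂ (π₁ ⊖ π₂) k₂ 0 toℕ-⊖-↑ˡ toℕ-⊖-↑ʳ

  ⊕-isPerm : IsPerm π₁ → IsPerm π₂ → IsPerm (π₁ ⊕ π₂)
  ⊕-isPerm (π₁-injective , _) (π₂-injective , _) = injective⇒isPerm
    (⊕-Blocks.injective π₁-injective π₂-injective λ y y' → Finₚ.<⇒≢ (⊕-↑ˡ<↑ʳ y y'))

  ⊖-isPerm : IsPerm π₁ → IsPerm π₂ → IsPerm (π₁ ⊖ π₂)
  ⊖-isPerm (π₁-injective , _) (π₂-injective , _) = injective⇒isPerm
    (⊖-Blocks.injective π₁-injective π₂-injective λ y y' → Finₚ.<⇒≢ (⊖-↑ʳ<↑ˡ y y') ∘ sym)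

  ⊕-occurrence-in-block : ∀ {k} {τ : Fin k → Fin k} → SumIndecomposable τ →
                          Occurs τ (π₁ ⊕ π₂) → Occurs τ π₁ ⊎ Occurs τ π₂
  ⊕-occurrence-in-block indecomposable (e , occurrence@(increasing , preserves))
    with placement k₁ increasing
  ... | below inLeft  = inj₁ (⊕-Blocks.restrictˡ occurrence inLeft)
  ... | above inRight = inj₂ (⊕-Blocks.restrictʳ occurrence inRight)
  ... | split m 0<m inLeft inRight with indecomposable m 0<m
  ...   | l , l' , l<m , m≤l' , τl>τl' =
    contradiction (preserves l' l τl>τl')
      (ℕₚ.<-asym (across-blocks (λ x z → (π₁ ⊕ π₂) x Fin.< (π₁ ⊕ π₂) z) ⊕-↑ˡ<↑ʳ
                                (inLeft l l<m) (inRight l' m≤l')))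

  ⊖-occurrence-in-block : ∀ {k} {τ : Fin k → Fin k} → SkewIndecomposable τ →
                          Occurs τ (π₁ ⊖ π₂) → Occurs τ π₁ ⊎ Occurs τ π₂
  ⊖-occurrence-in-block indecomposable (e , occurrence@(increasing , preserves))
    with placement k₁ increasing
  ... | below inLeft  = inj₁ (⊖-Blocks.restrictˡ occurrence inLeft)
  ... | above inRight = inj₂ (⊖-Blocks.restrictʳ occurrence inRight)
  ... | split m 0<m inLeft inRight with indecomposable m 0<m
  ...   | l , l' , l<m , m≤l' , τl<τl' =
    contradiction (preserves l l' τl<τl')
      (ℕₚ.<-asym (across-blocks (λ x z → (π₁ ⊖ π₂) z Fin.< (π₁ ⊖ π₂) x) ⊖-↑ʳ<↑ˡ
                                (inLeft l l<m) (inRight l' m≤l')))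

  ⊕-separable : Separable π₁ → Separable π₂ → Separable (π₁ ⊕ π₂)
  ⊕-separable (∌2413₁ , ∌3142₁) (∌2413₂ , ∌3142₂) =
    [ ∌2413₁ , ∌2413₂ ]′ ∘ ⊕-occurrence-in-block 2413-sumIndecomposable ,
    [ ∌3142₁ , ∌3142₂ ]′ ∘ ⊕-occurrence-in-block 3142-sumIndecomposable

  ⊖-separable : Separable π₁ → Separable π₂ → Separable (π₁ ⊖ π₂)
  ⊖-separable (∌2413₁ , ∌3142₁) (∌2413₂ , ∌3142₂) =
    [ ∌2413₁ , ∌2413₂ ]′ ∘ ⊖-occurrence-in-block 2413-skewIndecomposable ,
    [ ∌3142₁ , ∌3142₂ ]′ ∘ ⊖-occurrence-in-block 3142-skewIndecomposable

  ⊕-occursIn : ∀ {n} (σ : Fin n → Fin n) {i h j a c b : ℤ} → i < h → h ≤ j → a < c → c ≤ b →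
               OccursIn π₁ σ i (h - + 1) a (c - + 1) → OccursIn π₂ σ h j c b →
               OccursIn (π₁ ⊕ π₂) σ i j a b
  ⊕-occursIn σ {i} {h} {j} {a} {c} {b} i<h h≤j a<c c≤b
             (e₁ , increasing₁ , preserves₁ , index₁ , value₁)
             (e₂ , increasing₂ , preserves₂ , index₂ , value₂)
    with increasing , preserves ← ⊕-Blocks.++-isOccurrence {σ = σ}
           (increasing₁ , preserves₁) (increasing₂ , preserves₂)
           (λ y y' → lower-part-<-upper-part (index₁ y) (index₂ y'))
           (λ y y' _ → lower-part-<-upper-part (value₁ y) (value₂ y'))
           (λ y y' down → contradiction down (ℕₚ.<-asym (⊕-↑ˡ<↑ʳ y y')))
    = e₁ ++ e₂ , increasing , preserves ,
      ++⁺ (λ x → InInterval i j (pos x))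
          (lower-part-⊆ h≤j ∘ index₁) (upper-part-⊆ i<h ∘ index₂) ,
      ++⁺ (λ x → InInterval a b (pos (σ x)))
          (lower-part-⊆ c≤b ∘ value₁) (upper-part-⊆ a<c ∘ value₂)

  ⊖-occursIn : ∀ {n} (σ : Fin n → Fin n) {i h j a c b : ℤ} → i < h → h ≤ j → a < c → c ≤ b →
               OccursIn π₁ σ i (h - + 1) c b → OccursIn π₂ σ h j a (c - + 1) →
               OccursIn (π₁ ⊖ π₂) σ i j a b
  ⊖-occursIn σ {i} {h} {j} {a} {c} {b} i<h h≤j a<c c≤b
             (e₁ , increasing₁ , preserves₁ , index₁ , value₁)
             (e₂ , increasing₂ , preserves₂ , index₂ , value₂)
    with increasing , preserves ← ⊖-Blocks.++-isOccurrence {σ = σ}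
           (increasing₁ , preserves₁) (increasing₂ , preserves₂)
           (λ y y' → lower-part-<-upper-part (index₁ y) (index₂ y'))
           (λ y y' up → contradiction up (ℕₚ.<-asym (⊖-↑ʳ<↑ˡ y y')))
           (λ y y' _ → lower-part-<-upper-part (value₂ y') (value₁ y))
    = e₁ ++ e₂ , increasing , preserves ,
      ++⁺ (λ x → InInterval i j (pos x))
          (lower-part-⊆ h≤j ∘ index₁) (upper-part-⊆ i<h ∘ index₂) ,
      ++⁺ (λ x → InInterval a b (pos (σ x)))
          (upper-part-⊆ a<c ∘ value₁) (lower-part-⊆ c≤b ∘ value₂)

lemma1 : (K : ℕ) (n : Fin K → ℕ) (σ : (q : Fin K) → Fin (n q) → Fin (n q)) →
         (∀ q → IsPerm (σ q)) →
         (i h j a c b : Fin K → ℤ) →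
         (∀ q → i q < h q) → (∀ q → h q ≤ j q) →
         (∀ q → a q < c q) → (∀ q → c q ≤ b q) →
         {k₁ k₂ : ℕ} (π₁ : Fin k₁ → Fin k₁) (π₂ : Fin k₂ → Fin k₂) →
         IsPerm π₁ → Separable π₁ → IsPerm π₂ → Separable π₂ →
         ((∀ q → OccursIn π₁ (σ q) (i q) (h q - + 1) (a q) (c q - + 1)) →
          (∀ q → OccursIn π₂ (σ q) (h q) (j q) (c q) (b q)) →
          IsPerm (π₁ ⊕ π₂) × Separable (π₁ ⊕ π₂) ×
          (∀ q → OccursIn (π₁ ⊕ π₂) (σ q) (i q) (j q) (a q) (b q)))
         ×
         ((∀ q → OccursIn π₁ (σ q) (i q) (h q - + 1) (c q) (b q)) →
          (∀ q → OccursIn π₂ (σ q) (h q) (j q) (a q) (c q - + 1)) →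
          IsPerm (π₁ ⊖ π₂) × Separable (π₁ ⊖ π₂) ×
          (∀ q → OccursIn (π₁ ⊖ π₂) (σ q) (i q) (j q) (a q) (b q)))
lemma1 K n σ _ i h j a c b i<h h≤j a<c c≤b π₁ π₂ π₁-perm π₁-sep π₂-perm π₂-sep =
  (λ occurs₁ occurs₂ →
     ⊕-isPerm π₁ π₂ π₁-perm π₂-perm , ⊕-separable π₁ π₂ π₁-sep π₂-sep ,
     λ q → ⊕-occursIn π₁ π₂ (σ q) (i<h q) (h≤j q) (a<c q) (c≤b q) (occurs₁ q) (occurs₂ q)) ,
  (λ occurs₁ occurs₂ →
     ⊖-isPerm π₁ π₂ π₁-perm π₂-perm , ⊖-separable π₁ π₂ π₁-sep π₂-sep ,
     λ q → ⊖-occursIn π₁ π₂ (σ q) (i<h q) (h≤j q) (a<c q) (c≤b q) (occurs₁ q) (occurs₂ q))
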